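{- For positive integers $n,s$, $$\sum_{m=1}^{n}\sum_{q=1}^{\min(m,s)}\binom{s}{q}\binom{ -1+\frac{m}{2}}{q-1}'=-1+\binom{s+\lfloor n/2\rfloor}{s}.$$
   Context: For real $p$ and integer $q$, $\binom{p}{q}'$ denotes $\binom{p}{q}$ if $p$ and $q$ are nonnegative integers, and $0$ otherwise. $\lfloor x\rfloor$ is the integer part. -}

module Defs where

open import Data.Nat using (ℕ; zero; suc; _≟_)
open import Data.Nat.Combinatorics using (_C_)
open import Data.Integer using (ℤ; +_; -[1+_]; _+_)
open import Data.Rational using (ℚ)
open import Relation.Nullary using (yes; no)

Σ₁ : ℕ → (ℕ → ℤ) → ℤ
Σ₁ zero f = + 0
Σ₁ (suc n) f = Σ₁ n f + f (suc n)

-- binom' p q = (p choose q) if p and q are nonnegative integers, 0 otherwise.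
-- A rational p is a nonnegative integer iff its (normalised) denominator is 1
-- and its numerator is nonnegative.
binom' : ℚ → ℤ → ℤ
binom' p -[1+ _ ] = + 0
binom' p (+ j) with ℚ.denominatorℕ p ≟ 1 | ℚ.numerator p
... | yes _ | + k = + (k C j)
... | yes _ | -[1+ _ ] = + 0
... | no _ | _ = + 0

module Submission where

-- Write P m = -1 + m/2 and F m = Σ_{q=1}^{min(m,s)} C(s,q)·binom'(P m, q-1) for the
-- inner sum of the identity (s ≥ 1 fixed).
--  * For odd m the number P m is not an integer, so every binom' vanishes and F m = 0.
--  * For m = 2k+2 we have P m = k, hence F m = Σ_{j<s} C(s,j+1)·C(k,j); cutting the
--    range at min(m,s) loses nothing since the omitted terms vanish.  As
--    C(s,j+1) = C(s,s-1-j), Vandermonde's convolution gives F m = C(k+s, s-1).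
--  * Summing over m, the odd terms contribute nothing and Pascal's rule telescopes the
--    even ones: 1 + Σ_{m ≤ 2K} F m = C(s+K, s), and likewise up to 2K+1.
-- Writing n = n mod 2 + 2⌊n/2⌋ then gives the theorem.

module Convolution where
  open import Data.Nat
  open import Data.Nat.Properties
  open import Data.Nat.Combinatorics using (_C_; k>n⇒nCk≡0; nCk+nC[k+1]≡[n+1]C[k+1])
  open import Algebra.Properties.CommutativeSemigroup +-commutativeSemigroup
    using (interchange)
  open import Relation.Binary.PropositionalEquality
  open ≡-Reasoning

  sum< : ℕ → (ℕ → ℕ) → ℕ
  sum< zero g = 0
  sum< (suc n) g = g 0 + sum< n (λ i → g (suc i))

  sum<-snoc : ∀ n g → sum< (suc n) g ≡ sum< n g + g n
  sum<-snoc zero g = +-identityʳ (g 0)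
  sum<-snoc (suc n) g = begin
    g 0 + sum< (suc n) (λ i → g (suc i)) ≡⟨ cong (g 0 +_) (sum<-snoc n (λ i → g (suc i))) ⟩
    g 0 + (sum< n (λ i → g (suc i)) + g (suc n)) ≡⟨ +-assoc (g 0) _ _ ⟨
    sum< (suc n) g + g (suc n) ∎

  sum<-cong : ∀ n {g h} → (∀ i → i < n → g i ≡ h i) → sum< n g ≡ sum< n h
  sum<-cong zero e = refl
  sum<-cong (suc n) e = cong₂ _+_ (e 0 z<s) (sum<-cong n (λ i i<n → e (suc i) (s<s i<n)))

  sum<-zero : ∀ n g → (∀ i → g i ≡ 0) → sum< n g ≡ 0
  sum<-zero zero g e = refl
  sum<-zero (suc n) g e = cong₂ _+_ (e 0) (sum<-zero n _ (λ i → e (suc i)))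

  sum<-+ : ∀ n g h → sum< n (λ i → g i + h i) ≡ sum< n g + sum< n h
  sum<-+ zero g h = refl
  sum<-+ (suc n) g h =
    trans (cong (g 0 + h 0 +_) (sum<-+ n _ _)) (interchange (g 0) (h 0) _ _)

  sum<-vanishing-tail : ∀ {M N} g → M ≤ N → (∀ i → M ≤ i → g i ≡ 0) →
                        sum< N g ≡ sum< M g
  sum<-vanishing-tail {N = N} g z≤n e = sum<-zero N g (λ i → e i z≤n)
  sum<-vanishing-tail g (s≤s M≤N) e =
    cong (g 0 +_) (sum<-vanishing-tail _ M≤N (λ i M≤i → e (suc i) (s≤s M≤i)))

  vandermonde : ∀ a b n → sum< (suc n) (λ j → (a C j) * (b C (n ∸ j))) ≡ (a + b) C n
  vandermonde zero b n = begin
    1 * (b C n) + sum< n (λ j → (0 C suc j) * (b C (n ∸ suc j)))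
      ≡⟨ cong (1 * (b C n) +_) (sum<-zero n _ (λ j → cong (_* (b C (n ∸ suc j))) (k>n⇒nCk≡0 (z<s {j})))) ⟩
    1 * (b C n) + 0 ≡⟨ +-identityʳ _ ⟩
    1 * (b C n) ≡⟨ *-identityˡ _ ⟩
    b C n ∎
  vandermonde (suc a) b zero = refl
  vandermonde (suc a) b (suc n) = begin
    1 * (b C suc n) + sum< (suc n) (λ i → (suc a C suc i) * (b C (n ∸ i)))
      ≡⟨ cong (1 * (b C suc n) +_) pascal-split ⟩
    1 * (b C suc n) + (sum< (suc n) (λ i → (a C suc i) * (b C (n ∸ i)))
                       + sum< (suc n) (λ i → (a C i) * (b C (n ∸ i))))
      ≡⟨ +-assoc (1 * (b C suc n)) _ _ ⟨
    sum< (suc (suc n)) (λ j → (a C j) * (b C (suc n ∸ j)))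
      + sum< (suc n) (λ i → (a C i) * (b C (n ∸ i)))
      ≡⟨ cong₂ _+_ (vandermonde a b (suc n)) (vandermonde a b n) ⟩
    (a + b) C suc n + (a + b) C n ≡⟨ +-comm ((a + b) C suc n) _ ⟩
    (a + b) C n + (a + b) C suc n ≡⟨ nCk+nC[k+1]≡[n+1]C[k+1] (a + b) n ⟩
    suc (a + b) C suc n ∎
    where
    pascal-split : sum< (suc n) (λ i → (suc a C suc i) * (b C (n ∸ i)))
                 ≡ sum< (suc n) (λ i → (a C suc i) * (b C (n ∸ i)))
                   + sum< (suc n) (λ i → (a C i) * (b C (n ∸ i)))
    pascal-split = trans (sum<-cong (suc n) termwise)
                         (sum<-+ (suc n) (λ i → (a C suc i) * (b C (n ∸ i)))
                                         (λ i → (a C i) * (b C (n ∸ i))))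
      where
      termwise : ∀ i → i < suc n →
                 (suc a C suc i) * (b C (n ∸ i))
                 ≡ (a C suc i) * (b C (n ∸ i)) + (a C i) * (b C (n ∸ i))
      termwise i _ = begin
        (suc a C suc i) * (b C (n ∸ i))
          ≡⟨ cong (_* (b C (n ∸ i))) (nCk+nC[k+1]≡[n+1]C[k+1] a i) ⟨
        (a C i + a C suc i) * (b C (n ∸ i))
          ≡⟨ cong (_* (b C (n ∸ i))) (+-comm (a C i) _) ⟩
        (a C suc i + a C i) * (b C (n ∸ i))
          ≡⟨ *-distribʳ-+ (b C (n ∸ i)) (a C suc i) _ ⟩
        (a C suc i) * (b C (n ∸ i)) + (a C i) * (b C (n ∸ i)) ∎

module HalfIntegers where
  open import Data.Nat as ℕ using (ℕ; zero; suc)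
  open import Data.Nat.DivMod using (_%_; m*n%n≡0; [m+kn]%n≡m%n)
  open import Data.Nat.Combinatorics using (_C_)
  open import Data.Integer as ℤ using (ℤ; +_; -[1+_])
  import Data.Integer.Properties as ℤ
  open import Data.Integer.Tactic.RingSolver using (solve-∀)
  open import Data.Rational as ℚ using (ℚ; mkℚ; _/_)
  open import Data.Rational.Literals using (fromℤ)
  import Data.Rational.Properties as ℚ
  open import Data.Rational.Unnormalised as ℚᵘ using (mkℚᵘ; _≃_; *≡*)
  import Data.Rational.Unnormalised.Properties as ℚᵘ
  open import Relation.Binary.PropositionalEquality
  open import Relation.Nullary using (¬_; yes; no)
  open import Data.Empty using (⊥-elim)
  open import Defs using (binom')
  open ≡-Reasoning

  halfShift : ℕ → ℚ
  halfShift m = ℚ.-_ ℚ.1ℚ ℚ.+ ((+ m) / 2)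

  halfShift-fraction : ∀ m → ℚ.toℚᵘ (halfShift m) ≃ mkℚᵘ (+ m ℤ.- + 2) 1
  halfShift-fraction m = ℚᵘ.≃-trans
    (ℚᵘ.≃-trans (ℚ.toℚᵘ-homo-+ (ℚ.-_ ℚ.1ℚ) ((+ m) / 2))
                (ℚᵘ.+-congʳ (mkℚᵘ -[1+ 0 ] 0) (ℚ.toℚᵘ-fromℚᵘ (mkℚᵘ (+ m) 1))))
    (*≡* (cross (+ m)))
    where
    cross : ∀ z → (-[1+ 0 ] ℤ.* + 2 ℤ.+ z ℤ.* + 1) ℤ.* + 2 ≡ (z ℤ.- + 2) ℤ.* (+ 2 ℤ.* + 1)
    cross = solve-∀

  half-integral : ∀ {a z} → mkℚᵘ a 1 ≃ mkℚᵘ z 0 → a ≡ z ℤ.* + 2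
  half-integral {a} (*≡* a*1≡z*2) = trans (sym (ℤ.*-identityʳ a)) a*1≡z*2

  denominator-one : ∀ p → ℚ.denominatorℕ p ≡ 1 → ℚ.toℚᵘ p ≃ mkℚᵘ (ℚ.numerator p) 0
  denominator-one (mkℚ _ zero _) _ = ℚᵘ.≃-refl

  odd≢twice : ∀ k w → + suc (k ℕ.* 2) ≢ w ℤ.* + 2
  odd≢twice k (+ a) e = 1≢0 (begin
    1                    ≡⟨ [m+kn]%n≡m%n 1 k 2 ⟨
    suc (k ℕ.* 2) % 2    ≡⟨ cong (_% 2) (ℤ.+-injective (trans e (sym (ℤ.pos-* a 2)))) ⟩
    (a ℕ.* 2) % 2        ≡⟨ m*n%n≡0 a 2 ⟩
    0 ∎)
    where 1≢0 : 1 ≢ 0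
          1≢0 ()
  odd≢twice k -[1+ a ] ()

  halfShift-even : ∀ k → halfShift (suc (suc (k ℕ.* 2))) ≡ fromℤ (+ k)
  halfShift-even k = ℚ.toℚᵘ-injective
    (ℚᵘ.≃-trans (halfShift-fraction (suc (suc (k ℕ.* 2))))
                (*≡* (trans (ℤ.*-identityʳ _) (ℤ.pos-* k 2))))

  halfShift-odd : ∀ k → ¬ (ℚ.denominatorℕ (halfShift (suc (k ℕ.* 2))) ≡ 1)
  halfShift-odd k den≡1 = odd≢twice k (ℚ.numerator p ℤ.+ + 1) (begin
      + suc (k ℕ.* 2)                          ≡⟨ shift (+ suc (k ℕ.* 2)) ⟩
      (+ suc (k ℕ.* 2) ℤ.- + 2) ℤ.+ + 2        ≡⟨ cong (ℤ._+ + 2) twice ⟩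
      ℚ.numerator p ℤ.* + 2 ℤ.+ + 2            ≡⟨ factor (ℚ.numerator p) ⟩
      (ℚ.numerator p ℤ.+ + 1) ℤ.* + 2 ∎)
    where
    p : ℚ
    p = halfShift (suc (k ℕ.* 2))
    twice : + suc (k ℕ.* 2) ℤ.- + 2 ≡ ℚ.numerator p ℤ.* + 2
    twice = half-integral (ℚᵘ.≃-trans (ℚᵘ.≃-sym (halfShift-fraction (suc (k ℕ.* 2))))
                                     (denominator-one p den≡1))
    shift : ∀ z → z ≡ (z ℤ.- + 2) ℤ.+ + 2
    shift = solve-∀
    factor : ∀ z → z ℤ.* + 2 ℤ.+ + 2 ≡ (z ℤ.+ + 1) ℤ.* + 2
    factor = solve-∀

  binom'-natural : ∀ k j → binom' (fromℤ (+ k)) (+ j) ≡ + (k C j)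
  binom'-natural k j = refl

  binom'-nonintegral : ∀ p z → ¬ (ℚ.denominatorℕ p ≡ 1) → binom' p z ≡ + 0
  binom'-nonintegral p -[1+ _ ] _ = refl
  binom'-nonintegral p (+ j) den≢1 with ℚ.denominatorℕ p ℕ.≟ 1 | ℚ.numerator p
  ... | yes den≡1 | _ = ⊥-elim (den≢1 den≡1)
  ... | no _ | _ = refl

module InnerSum where
  open import Data.Nat as ℕ using (ℕ; zero; suc; _⊓_; _≤_; _<_; s≤s)
  import Data.Nat.Properties as ℕ
  open import Data.Nat.DivMod using (_/_; _%_; m≡m%n+[m/n]*n; m%n<n)
  open import Data.Nat.Combinatorics using (_C_; nCk≡nC[n∸k]; nCk+nC[k+1]≡[n+1]C[k+1]; k>n⇒nCk≡0; nCn≡1)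
  open import Data.Integer as ℤ using (ℤ; +_)
  import Data.Integer.Properties as ℤ
  open import Data.Integer.Tactic.RingSolver using (solve-∀)
  open import Data.Sum using (inj₁; inj₂)
  open import Relation.Binary.PropositionalEquality
  open import Data.Rational.Literals using (fromℤ)
  open import Defs using (Σ₁; binom')
  open Convolution
  open HalfIntegers
  open ≡-Reasoning

  Σ₁-as-sum< : ∀ n (f : ℕ → ℤ) g → (∀ j → f (suc j) ≡ + g j) → Σ₁ n f ≡ + sum< n g
  Σ₁-as-sum< zero f g e = refl
  Σ₁-as-sum< (suc n) f g e = begin
    Σ₁ n f ℤ.+ f (suc n)    ≡⟨ cong₂ ℤ._+_ (Σ₁-as-sum< n f g e) (e n) ⟩
    + (sum< n g ℕ.+ g n)    ≡⟨ cong +_ (sum<-snoc n g) ⟨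
    + sum< (suc n) g ∎

  module _ (s' : ℕ) where
    s : ℕ
    s = suc s'

    inner : ℕ → ℤ
    inner m = Σ₁ (m ⊓ s) (λ q → + (s C q) ℤ.* binom' (halfShift m) ((+ q) ℤ.- (+ 1)))

    inner-odd : ∀ k → inner (suc (k ℕ.* 2)) ≡ + 0
    inner-odd k = begin
      inner m                      ≡⟨ Σ₁-as-sum< (m ⊓ s) _ (λ _ → 0) vanishes ⟩
      + sum< (m ⊓ s) (λ _ → 0)     ≡⟨ cong +_ (sum<-zero (m ⊓ s) _ (λ _ → refl)) ⟩
      + 0 ∎
      where
      m : ℕ
      m = suc (k ℕ.* 2)
      vanishes : ∀ j → + (s C suc j) ℤ.* binom' (halfShift m) (+ j) ≡ + 0
      vanishes j = trans (cong (+ (s C suc j) ℤ.*_) (binom'-nonintegral _ _ (halfShift-odd k)))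
                         (ℤ.*-zeroʳ (+ (s C suc j)))

    inner-even : ∀ k → inner (suc (suc (k ℕ.* 2))) ≡ + ((k ℕ.+ s) C s')
    inner-even k = begin
      inner m                ≡⟨ Σ₁-as-sum< (m ⊓ s) _ term natural-terms ⟩
      + sum< (m ⊓ s) term    ≡⟨ cong +_ (sum<-vanishing-tail term (ℕ.m⊓n≤n m s) tail) ⟨
      + sum< s term          ≡⟨ cong +_ (sum<-cong s symmetric) ⟩
      + sum< s (λ j → (k C j) ℕ.* (s C (s' ℕ.∸ j)))  ≡⟨ cong +_ (vandermonde k s s') ⟩
      + ((k ℕ.+ s) C s') ∎
      where
      m : ℕ
      m = suc (suc (k ℕ.* 2))
      term : ℕ → ℕ
      term j = (s C suc j) ℕ.* (k C j)
      natural-terms : ∀ j → + (s C suc j) ℤ.* binom' (halfShift m) (+ j) ≡ + term j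
      natural-terms j = begin
        + (s C suc j) ℤ.* binom' (halfShift m) (+ j)
          ≡⟨ cong (λ p → + (s C suc j) ℤ.* binom' p (+ j)) (halfShift-even k) ⟩
        + (s C suc j) ℤ.* binom' (fromℤ (+ k)) (+ j)
          ≡⟨ cong (+ (s C suc j) ℤ.*_) (binom'-natural k j) ⟩
        + (s C suc j) ℤ.* + (k C j)
          ≡⟨ ℤ.pos-* (s C suc j) (k C j) ⟨
        + term j ∎
      -- Beyond min(m,s) a factor vanishes: C(k,j) = 0 for j ≥ m > k, C(s,j+1) = 0 for j ≥ s.
      tail : ∀ j → m ⊓ s ≤ j → term j ≡ 0
      tail j M≤j with ℕ.⊓-sel m s
      ... | inj₁ M≡m = trans (cong ((s C suc j) ℕ.*_) (k>n⇒nCk≡0 k<j)) (ℕ.*-zeroʳ (s C suc j))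
        where k<j : k < j
              k<j = ℕ.<-≤-trans (s≤s (ℕ.m≤m*n k 2)) (ℕ.≤-trans (ℕ.n≤1+n _) (subst (_≤ j) M≡m M≤j))
      ... | inj₂ M≡s = cong (ℕ._* (k C j)) (k>n⇒nCk≡0 (s≤s (subst (_≤ j) M≡s M≤j)))
      symmetric : ∀ j → j < s → term j ≡ (k C j) ℕ.* (s C (s' ℕ.∸ j))
      symmetric j j<s = trans (cong (ℕ._* (k C j)) (nCk≡nC[n∸k] j<s)) (ℕ.*-comm _ (k C j))

    add-last : ∀ x y → x ℤ.+ y ℤ.+ + 1 ≡ x ℤ.+ + 1 ℤ.+ y
    add-last = solve-∀

    telescope-odd : ∀ K → Σ₁ (suc (K ℕ.* 2)) inner ℤ.+ + 1 ≡ + ((s ℕ.+ K) C s)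
    telescope-even : ∀ K → Σ₁ (K ℕ.* 2) inner ℤ.+ + 1 ≡ + ((s ℕ.+ K) C s)

    telescope-odd K = begin
      Σ₁ (K ℕ.* 2) inner ℤ.+ inner (suc (K ℕ.* 2)) ℤ.+ + 1
        ≡⟨ add-last (Σ₁ (K ℕ.* 2) inner) _ ⟩
      Σ₁ (K ℕ.* 2) inner ℤ.+ + 1 ℤ.+ inner (suc (K ℕ.* 2))
        ≡⟨ cong₂ ℤ._+_ (telescope-even K) (inner-odd K) ⟩
      + ((s ℕ.+ K) C s ℕ.+ 0)
        ≡⟨ cong +_ (ℕ.+-identityʳ _) ⟩
      + ((s ℕ.+ K) C s) ∎

    telescope-even zero = cong +_ (trans (sym (nCn≡1 s)) (cong (_C s) (sym (ℕ.+-identityʳ s))))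
    telescope-even (suc K) = begin
      Σ₁ (suc (K ℕ.* 2)) inner ℤ.+ inner (suc (suc (K ℕ.* 2))) ℤ.+ + 1
        ≡⟨ add-last (Σ₁ (suc (K ℕ.* 2)) inner) _ ⟩
      Σ₁ (suc (K ℕ.* 2)) inner ℤ.+ + 1 ℤ.+ inner (suc (suc (K ℕ.* 2)))
        ≡⟨ cong₂ ℤ._+_ (telescope-odd K) (inner-even K) ⟩
      + ((s ℕ.+ K) C s ℕ.+ (K ℕ.+ s) C s')
        ≡⟨ cong (λ x → + ((s ℕ.+ K) C s ℕ.+ x C s')) (ℕ.+-comm K s) ⟩
      + ((s ℕ.+ K) C s ℕ.+ (s ℕ.+ K) C s')
        ≡⟨ cong +_ (ℕ.+-comm ((s ℕ.+ K) C s) _) ⟩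
      + ((s ℕ.+ K) C s' ℕ.+ (s ℕ.+ K) C s)
        ≡⟨ cong +_ (nCk+nC[k+1]≡[n+1]C[k+1] (s ℕ.+ K) s') ⟩
      + (suc (s ℕ.+ K) C s)
        ≡⟨ cong (λ x → + (x C s)) (ℕ.+-suc s K) ⟨
      + ((s ℕ.+ suc K) C s) ∎

    telescope : ∀ n → Σ₁ n inner ℤ.+ + 1 ≡ + ((s ℕ.+ n / 2) C s)
    telescope n = subst (λ x → Σ₁ x inner ℤ.+ + 1 ≡ + ((s ℕ.+ n / 2) C s))
                        (sym (m≡m%n+[m/n]*n n 2)) (by-parity (n % 2) (m%n<n n 2))
      where
      by-parity : ∀ r → r < 2 → Σ₁ (r ℕ.+ n / 2 ℕ.* 2) inner ℤ.+ + 1 ≡ + ((s ℕ.+ n / 2) C s)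
      by-parity 0 _ = telescope-even (n / 2)
      by-parity 1 _ = telescope-odd (n / 2)
      by-parity (suc (suc _)) (s≤s (s≤s ()))

open import Defs
open import Relation.Binary.PropositionalEquality using (_≡_; trans; cong)
import Data.Integer
open import Data.Nat using (ℕ; _≤_; _⊓_)
open import Data.Nat.Combinatorics using (_C_)
open import Data.Integer using (+_; _+_; _-_; -_)
open import Data.Integer.Tactic.RingSolver using (solve-∀)
open import Data.Rational using (_/_)
import Data.Rational as Q
import Data.Nat as N

-- The theorem holds for n = 0 as well; only s ≥ 1 is used.
lemma1 : (n s : ℕ) → 1 ≤ n → 1 ≤ s →
    Σ₁ n (λ m → Σ₁ (m ⊓ s) (λ q →
    + (s C q) Data.Integer.* binom' (Q.-_ Q.1ℚ Q.+ ((+ m) / 2)) ((+ q) - (+ 1))))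
    ≡ - (+ 1) + (+ ((s N.+ (n N./ 2)) C s))
lemma1 n N.zero _ ()
lemma1 n (N.suc s') _ _ = subtract-one (InnerSum.telescope s' n)
  where
  subtract-one : ∀ {x c} → x + + 1 ≡ c → x ≡ - (+ 1) + c
  subtract-one {x} x+1≡c = trans (shift x) (cong (λ y → - (+ 1) + y) x+1≡c)
    where
    shift : ∀ x → x ≡ - (+ 1) + (x + + 1)
    shift = solve-∀
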